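{- Let $r\geq 4$ and let $M_r$ be the matrix indexed by subsets of $[r]$ with $M_r(S,T)=\binom{|S\cap T|}{2}+\binom{|\overline{S}\cap\overline{T}|}{2}$, $\overline{S}=[r]\setminus S$. Let $W\in\mathbb{R}^{\mathcal{P}([r])}$ be defined by $W_T = \binom{|T|}{2}+\binom{r-|T|}{2}$. Then $W$ is an eigenvector of $M_r$ with eigenvalue $2^{r-4}(r^2-r+2)$.
   Context: $\mathcal{P}([r])$ is the power set of $[r]=\{1,\ldots,r\}$; $\binom{n}{2}=n(n-1)/2$. -}

module Defs where

open import Data.Nat using (ℕ; zero; suc; _+_; _*_; _∸_; _^_)
open import Data.Nat.Combinatorics using (_C_)
open import Data.Bool using (Bool; true; false)
open import Data.Vec using (Vec; []; _∷_)
open import Data.List using (List; []; _∷_; map; _++_)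
open import Data.Nat.ListAction using (sum)
open import Data.Fin.Subset using (Subset; _∩_; ∁; ∣_∣; inside; outside)

allSubsets : (r : ℕ) → List (Subset r)
allSubsets zero = [] ∷ []
allSubsets (suc r) = map (outside ∷_) (allSubsets r) ++ map (inside ∷_) (allSubsets r)

M : (r : ℕ) → Subset r → Subset r → ℕ
M r S T = (∣ S ∩ T ∣ C 2) + (∣ ∁ S ∩ ∁ T ∣ C 2)

W : (r : ℕ) → Subset r → ℕ
W r T = (∣ T ∣ C 2) + ((r ∸ ∣ T ∣) C 2)

MW : (r : ℕ) → Subset r → ℕ
MW r S = sum (map (λ T → M r S T * W r T) (allSubsets r))

eigenvalue : ℕ → ℕ
eigenvalue r = 2 ^ (r ∸ 4) * (r * r ∸ r + 2)

-- Since W(T) = W(∁T), complementing T turns the second summand of M_r(S,T) W_T into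
-- C(|∁S ∩ T|,2) W_T, so (M_r W)_S = Σ_T C(|S∩T|,2) W_T + Σ_T C(|∁S∩T|,2) W_T.  As C(|A∩T|,2)
-- counts the pairs of A inside T, and W_T depends only on |T|, Σ_T C(|A∩T|,2) W_T equals
-- C(|A|,2) times the sum of W over the supersets of one fixed pair, so (M_r W)_S = W_S · λ with λ that sum.
-- Evaluating λ with the moments Σ_T C(|T|,k) = C(n,k) 2^(n-k) yields 2^(r-4) (r² - r + 2).
module Submission where

open import Defs
open import Data.Nat using (ℕ; zero; suc; _+_; _*_; _∸_; _^_; _≤_; _≤?_; s≤s)
open import Data.Nat.Properties
open import Data.Nat.Combinatorics using (_C_; nC1≡n; nCk+nC[k+1]≡[n+1]C[k+1]; k>n⇒nCk≡0)
open import Data.Nat.ListAction using (sum)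
open import Data.Nat.ListAction.Properties using (sum-++)
open import Data.Nat.Tactic.RingSolver using (solve-∀)
open import Data.List using (List; map; _++_)
open import Data.Vec using ([]; _∷_)
open import Data.List.Properties using (map-++; map-∘; map-cong)
open import Data.Fin.Subset using (Subset; _∩_; ∁; ∣_∣; inside; outside; ⊤; ⊥)
open import Data.Fin.Subset.Properties using (∣p∣≤n; ∣⊤∣≡n; ∣⊥∣≡0; ∣∁p∣≡n∸∣p∣; ∩-identityˡ)
open import Data.Product using (Σ; _×_; _,_)
open import Algebra.Properties.CommutativeSemigroup +-commutativeSemigroup using (interchange)
open import Relation.Nullary using (yes; no)
open import Relation.Binary.PropositionalEquality
open ≡-Reasoning

sumSubsets : (r : ℕ) → (Subset r → ℕ) → ℕ
sumSubsets r f = sum (map f (allSubsets r))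

sumSubsets-suc : ∀ r (f : Subset (suc r) → ℕ) →
  sumSubsets (suc r) f ≡ sumSubsets r (λ T → f (outside ∷ T)) + sumSubsets r (λ T → f (inside ∷ T))
sumSubsets-suc r f = begin
  sum (map f (map (outside ∷_) Ts ++ map (inside ∷_) Ts))
    ≡⟨ cong sum (map-++ f (map (outside ∷_) Ts) (map (inside ∷_) Ts)) ⟩
  sum (map f (map (outside ∷_) Ts) ++ map f (map (inside ∷_) Ts))
    ≡⟨ sum-++ (map f (map (outside ∷_) Ts)) _ ⟩
  sum (map f (map (outside ∷_) Ts)) + sum (map f (map (inside ∷_) Ts))
    ≡⟨ sym (cong₂ _+_ (cong sum (map-∘ Ts)) (cong sum (map-∘ Ts))) ⟩
  sumSubsets r (λ T → f (outside ∷ T)) + sumSubsets r (λ T → f (inside ∷ T)) ∎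
  where
  Ts : List (Subset r)
  Ts = allSubsets r

sumSubsets-cong : ∀ r {f g : Subset r → ℕ} → (∀ T → f T ≡ g T) → sumSubsets r f ≡ sumSubsets r g
sumSubsets-cong r f≗g = cong sum (map-cong f≗g (allSubsets r))

sumSubsets-+ : ∀ r (f g : Subset r → ℕ) →
  sumSubsets r (λ T → f T + g T) ≡ sumSubsets r f + sumSubsets r g
sumSubsets-+ zero f g = trans (+-identityʳ _) (sym (cong₂ _+_ (+-identityʳ (f [])) (+-identityʳ (g []))))
sumSubsets-+ (suc r) f g = begin
  sumSubsets (suc r) (λ T → f T + g T)
    ≡⟨ sumSubsets-suc r _ ⟩
  sumSubsets r (λ T → f (outside ∷ T) + g (outside ∷ T)) + sumSubsets r (λ T → f (inside ∷ T) + g (inside ∷ T))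
    ≡⟨ cong₂ _+_ (sumSubsets-+ r _ _) (sumSubsets-+ r _ _) ⟩
  (fₒ + gₒ) + (fᵢ + gᵢ)
    ≡⟨ interchange fₒ gₒ fᵢ gᵢ ⟩
  (fₒ + fᵢ) + (gₒ + gᵢ)
    ≡⟨ sym (cong₂ _+_ (sumSubsets-suc r f) (sumSubsets-suc r g)) ⟩
  sumSubsets (suc r) f + sumSubsets (suc r) g ∎
  where
  fₒ fᵢ gₒ gᵢ : ℕ
  fₒ = sumSubsets r (λ T → f (outside ∷ T))
  fᵢ = sumSubsets r (λ T → f (inside ∷ T))
  gₒ = sumSubsets r (λ T → g (outside ∷ T))
  gᵢ = sumSubsets r (λ T → g (inside ∷ T))

sumSubsets-* : ∀ r c (f : Subset r → ℕ) → sumSubsets r (λ T → c * f T) ≡ c * sumSubsets r f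
sumSubsets-* zero c f = trans (+-identityʳ _) (cong (c *_) (sym (+-identityʳ (f []))))
sumSubsets-* (suc r) c f = begin
  sumSubsets (suc r) (λ T → c * f T)
    ≡⟨ sumSubsets-suc r _ ⟩
  sumSubsets r (λ T → c * f (outside ∷ T)) + sumSubsets r (λ T → c * f (inside ∷ T))
    ≡⟨ cong₂ _+_ (sumSubsets-* r c _) (sumSubsets-* r c _) ⟩
  c * sumSubsets r (λ T → f (outside ∷ T)) + c * sumSubsets r (λ T → f (inside ∷ T))
    ≡⟨ sym (*-distribˡ-+ c _ _) ⟩
  c * (sumSubsets r (λ T → f (outside ∷ T)) + sumSubsets r (λ T → f (inside ∷ T)))
    ≡⟨ cong (c *_) (sym (sumSubsets-suc r f)) ⟩
  c * sumSubsets (suc r) f ∎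

sumSubsets-∁ : ∀ r (f : Subset r → ℕ) → sumSubsets r (λ T → f (∁ T)) ≡ sumSubsets r f
sumSubsets-∁ zero f = refl
sumSubsets-∁ (suc r) f = begin
  sumSubsets (suc r) (λ T → f (∁ T))
    ≡⟨ sumSubsets-suc r _ ⟩
  sumSubsets r (λ T → f (inside ∷ ∁ T)) + sumSubsets r (λ T → f (outside ∷ ∁ T))
    ≡⟨ cong₂ _+_ (sumSubsets-∁ r _) (sumSubsets-∁ r _) ⟩
  sumSubsets r (λ T → f (inside ∷ T)) + sumSubsets r (λ T → f (outside ∷ T))
    ≡⟨ +-comm (sumSubsets r (λ T → f (inside ∷ T))) _ ⟩
  sumSubsets r (λ T → f (outside ∷ T)) + sumSubsets r (λ T → f (inside ∷ T))
    ≡⟨ sym (sumSubsets-suc r f) ⟩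
  sumSubsets (suc r) f ∎

sumSubsets-1 : ∀ r → sumSubsets r (λ _ → 1) ≡ 2 ^ r
sumSubsets-1 zero = refl
sumSubsets-1 (suc r) = begin
  sumSubsets (suc r) (λ _ → 1)  ≡⟨ sumSubsets-suc r _ ⟩
  sumSubsets r (λ _ → 1) + sumSubsets r (λ _ → 1)  ≡⟨ cong₂ _+_ (sumSubsets-1 r) (sumSubsets-1 r) ⟩
  2 ^ r + 2 ^ r  ≡⟨ cong (2 ^ r +_) (sym (+-identityʳ (2 ^ r))) ⟩
  2 ^ suc r ∎

-- If k > n both sides vanish, because a ≤ n forces a C k = 0.
sumSubsets-shift : ∀ {a n} k (g : ℕ → ℕ) → a ≤ n →
  (a C k) * sumSubsets (suc n ∸ k) (λ T → g (k + ∣ T ∣)) ≡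
  (a C k) * (sumSubsets (n ∸ k) (λ T → g (k + ∣ T ∣)) + sumSubsets (n ∸ k) (λ T → g (suc (k + ∣ T ∣))))
sumSubsets-shift {a} {n} k g a≤n with k ≤? n
... | yes k≤n = cong ((a C k) *_) (begin
  sumSubsets (suc n ∸ k) (λ T → g (k + ∣ T ∣))
    ≡⟨ cong (λ m → sumSubsets m (λ T → g (k + ∣ T ∣))) (+-∸-assoc 1 k≤n) ⟩
  sumSubsets (suc (n ∸ k)) (λ T → g (k + ∣ T ∣))
    ≡⟨ sumSubsets-suc (n ∸ k) _ ⟩
  sumSubsets (n ∸ k) (λ T → g (k + ∣ T ∣)) + sumSubsets (n ∸ k) (λ T → g (k + suc ∣ T ∣))
    ≡⟨ cong (sumSubsets (n ∸ k) (λ T → g (k + ∣ T ∣)) +_) (sumSubsets-cong (n ∸ k) (λ T → cong g (+-suc k ∣ T ∣))) ⟩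
  sumSubsets (n ∸ k) (λ T → g (k + ∣ T ∣)) + sumSubsets (n ∸ k) (λ T → g (suc (k + ∣ T ∣))) ∎)
... | no k≰n rewrite k>n⇒nCk≡0 (≤-<-trans a≤n (≰⇒> k≰n)) = refl

-- The right-hand sum is the sum of g |T| over the supersets T of a fixed k-subset of [r].
sumSubsets-∣∩∣C : ∀ {r} (A : Subset r) k (g : ℕ → ℕ) →
  sumSubsets r (λ T → (∣ A ∩ T ∣ C k) * g ∣ T ∣) ≡ (∣ A ∣ C k) * sumSubsets (r ∸ k) (λ T → g (k + ∣ T ∣))
sumSubsets-∣∩∣C {r} A zero g = sumSubsets-* r 1 (λ T → g ∣ T ∣)
sumSubsets-∣∩∣C [] (suc k) g = refl
sumSubsets-∣∩∣C {suc n} (outside ∷ A) k g = begin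
  sumSubsets (suc n) (λ T → (∣ (outside ∷ A) ∩ T ∣ C k) * g ∣ T ∣)
    ≡⟨ sumSubsets-suc n _ ⟩
  sumSubsets n (λ T → (∣ A ∩ T ∣ C k) * g ∣ T ∣) + sumSubsets n (λ T → (∣ A ∩ T ∣ C k) * g (suc ∣ T ∣))
    ≡⟨ cong₂ _+_ (sumSubsets-∣∩∣C A k g) (sumSubsets-∣∩∣C A k (λ j → g (suc j))) ⟩
  (∣ A ∣ C k) * X + (∣ A ∣ C k) * Y
    ≡⟨ sym (*-distribˡ-+ (∣ A ∣ C k) X Y) ⟩
  (∣ A ∣ C k) * (X + Y)
    ≡⟨ sym (sumSubsets-shift k g (∣p∣≤n A)) ⟩
  (∣ A ∣ C k) * sumSubsets (suc n ∸ k) (λ T → g (k + ∣ T ∣)) ∎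
  where
  X Y : ℕ
  X = sumSubsets (n ∸ k) (λ T → g (k + ∣ T ∣))
  Y = sumSubsets (n ∸ k) (λ T → g (suc (k + ∣ T ∣)))
sumSubsets-∣∩∣C {suc n} (inside ∷ A) (suc k) g = begin
  sumSubsets (suc n) (λ T → (∣ (inside ∷ A) ∩ T ∣ C suc k) * g ∣ T ∣)
    ≡⟨ sumSubsets-suc n _ ⟩
  Σ₁ + sumSubsets n (λ T → (suc ∣ A ∩ T ∣ C suc k) * g (suc ∣ T ∣))
    ≡⟨ cong (Σ₁ +_) (sumSubsets-cong n (λ T → pascal ∣ A ∩ T ∣ (g (suc ∣ T ∣)))) ⟩
  Σ₁ + sumSubsets n (λ T → (∣ A ∩ T ∣ C k) * g (suc ∣ T ∣) + (∣ A ∩ T ∣ C suc k) * g (suc ∣ T ∣))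
    ≡⟨ cong (Σ₁ +_) (sumSubsets-+ n _ _) ⟩
  Σ₁ + (sumSubsets n (λ T → (∣ A ∩ T ∣ C k) * g (suc ∣ T ∣)) + sumSubsets n (λ T → (∣ A ∩ T ∣ C suc k) * g (suc ∣ T ∣)))
    ≡⟨ cong₂ _+_ (sumSubsets-∣∩∣C A (suc k) g)
                 (cong₂ _+_ (sumSubsets-∣∩∣C A k (λ j → g (suc j))) (sumSubsets-∣∩∣C A (suc k) (λ j → g (suc j)))) ⟩
  c₁ * X + (c₀ * Z + c₁ * Y)
    ≡⟨ regroup c₀ c₁ X Y Z ⟩
  c₀ * Z + c₁ * (X + Y)
    ≡⟨ cong (c₀ * Z +_) (sym (sumSubsets-shift (suc k) g (∣p∣≤n A))) ⟩
  c₀ * Z + c₁ * Z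
    ≡⟨ sym (*-distribʳ-+ Z c₀ c₁) ⟩
  (c₀ + c₁) * Z
    ≡⟨ cong (_* Z) (nCk+nC[k+1]≡[n+1]C[k+1] ∣ A ∣ k) ⟩
  (suc ∣ A ∣ C suc k) * Z ∎
  where
  Σ₁ c₀ c₁ X Y Z : ℕ
  Σ₁ = sumSubsets n (λ T → (∣ A ∩ T ∣ C suc k) * g ∣ T ∣)
  c₀ = ∣ A ∣ C k
  c₁ = ∣ A ∣ C suc k
  X = sumSubsets (n ∸ suc k) (λ T → g (suc k + ∣ T ∣))
  Y = sumSubsets (n ∸ suc k) (λ T → g (suc (suc k + ∣ T ∣)))
  Z = sumSubsets (n ∸ k) (λ T → g (suc (k + ∣ T ∣)))
  pascal : ∀ x h → (suc x C suc k) * h ≡ (x C k) * h + (x C suc k) * h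
  pascal x h = trans (cong (_* h) (sym (nCk+nC[k+1]≡[n+1]C[k+1] x k))) (*-distribʳ-+ h (x C k) (x C suc k))
  regroup : ∀ c₀ c₁ X Y Z → c₁ * X + (c₀ * Z + c₁ * Y) ≡ c₀ * Z + c₁ * (X + Y)
  regroup = solve-∀

sumSubsets-C : ∀ n k → sumSubsets n (λ T → ∣ T ∣ C k) ≡ (n C k) * 2 ^ (n ∸ k)
sumSubsets-C n k = begin
  sumSubsets n (λ T → ∣ T ∣ C k)
    ≡⟨ sumSubsets-cong n (λ T → sym (trans (*-identityʳ _) (cong (λ U → ∣ U ∣ C k) (∩-identityˡ T)))) ⟩
  sumSubsets n (λ T → (∣ ⊤ ∩ T ∣ C k) * 1)
    ≡⟨ sumSubsets-∣∩∣C ⊤ k (λ _ → 1) ⟩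
  (∣ ⊤ {n} ∣ C k) * sumSubsets (n ∸ k) (λ _ → 1)
    ≡⟨ cong₂ (λ a s → (a C k) * s) (∣⊤∣≡n n) (sumSubsets-1 (n ∸ k)) ⟩
  (n C k) * 2 ^ (n ∸ k) ∎

2*[1+n]C2≡[1+n]*n : ∀ n → 2 * (suc n C 2) ≡ suc n * n
2*[1+n]C2≡[1+n]*n zero = refl
2*[1+n]C2≡[1+n]*n (suc n) = begin
  2 * (suc (suc n) C 2)            ≡⟨ cong (2 *_) (sym (nCk+nC[k+1]≡[n+1]C[k+1] (suc n) 1)) ⟩
  2 * (suc n C 1 + suc n C 2)      ≡⟨ *-distribˡ-+ 2 (suc n C 1) _ ⟩
  2 * (suc n C 1) + 2 * (suc n C 2) ≡⟨ cong₂ (λ a b → 2 * a + b) (nC1≡n (suc n)) (2*[1+n]C2≡[1+n]*n n) ⟩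
  2 * suc n + suc n * n            ≡⟨ expand n ⟩
  suc (suc n) * suc n ∎
  where
  expand : ∀ n → 2 * suc n + suc n * n ≡ suc (suc n) * suc n
  expand = solve-∀

[2+n]C2 : ∀ n → suc (suc n) C 2 ≡ n C 2 + 2 * (n C 1) + n C 0
[2+n]C2 n = begin
  suc (suc n) C 2          ≡⟨ sym (nCk+nC[k+1]≡[n+1]C[k+1] (suc n) 1) ⟩
  suc n C 1 + suc n C 2    ≡⟨ cong₂ _+_ (sym (nCk+nC[k+1]≡[n+1]C[k+1] n 0)) (sym (nCk+nC[k+1]≡[n+1]C[k+1] n 1)) ⟩
  (1 + n C 1) + (n C 1 + n C 2) ≡⟨ regroup (n C 1) (n C 2) ⟩
  n C 2 + 2 * (n C 1) + 1 ∎
  where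
  regroup : ∀ c₁ c₂ → (1 + c₁) + (c₁ + c₂) ≡ c₂ + 2 * c₁ + 1
  regroup = solve-∀

W-∁ : ∀ r (T : Subset r) → W r (∁ T) ≡ W r T
W-∁ r T = begin
  ∣ ∁ T ∣ C 2 + (r ∸ ∣ ∁ T ∣) C 2         ≡⟨ cong (λ c → c C 2 + (r ∸ c) C 2) (∣∁p∣≡n∸∣p∣ T) ⟩
  (r ∸ ∣ T ∣) C 2 + (r ∸ (r ∸ ∣ T ∣)) C 2 ≡⟨ cong (λ c → (r ∸ ∣ T ∣) C 2 + c C 2) (m∸[m∸n]≡n (∣p∣≤n T)) ⟩
  (r ∸ ∣ T ∣) C 2 + ∣ T ∣ C 2             ≡⟨ +-comm ((r ∸ ∣ T ∣) C 2) _ ⟩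
  W r T ∎

MW≡sum∣S∩T∣C2+sum∣∁S∩T∣C2 : ∀ r (S : Subset r) →
  MW r S ≡ sumSubsets r (λ T → (∣ S ∩ T ∣ C 2) * W r T) + sumSubsets r (λ T → (∣ ∁ S ∩ T ∣ C 2) * W r T)
MW≡sum∣S∩T∣C2+sum∣∁S∩T∣C2 r S = begin
  MW r S
    ≡⟨ sumSubsets-cong r (λ T → *-distribʳ-+ (W r T) (∣ S ∩ T ∣ C 2) _) ⟩
  sumSubsets r (λ T → (∣ S ∩ T ∣ C 2) * W r T + (∣ ∁ S ∩ ∁ T ∣ C 2) * W r T)
    ≡⟨ sumSubsets-+ r _ _ ⟩
  Σ₁ + sumSubsets r (λ T → (∣ ∁ S ∩ ∁ T ∣ C 2) * W r T)
    ≡⟨ cong (Σ₁ +_) (sumSubsets-cong r (λ T → cong ((∣ ∁ S ∩ ∁ T ∣ C 2) *_) (sym (W-∁ r T)))) ⟩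
  Σ₁ + sumSubsets r (λ T → (∣ ∁ S ∩ ∁ T ∣ C 2) * W r (∁ T))
    ≡⟨ cong (Σ₁ +_) (sumSubsets-∁ r (λ T → (∣ ∁ S ∩ T ∣ C 2) * W r T)) ⟩
  Σ₁ + sumSubsets r (λ T → (∣ ∁ S ∩ T ∣ C 2) * W r T) ∎
  where
  Σ₁ : ℕ
  Σ₁ = sumSubsets r (λ T → (∣ S ∩ T ∣ C 2) * W r T)

-- The sum of W_T over the sets T containing a fixed pair.
pairSum : ℕ → ℕ
pairSum r = sumSubsets (r ∸ 2) (λ T → (2 + ∣ T ∣) C 2 + (r ∸ (2 + ∣ T ∣)) C 2)

MW≡W*pairSum : ∀ r (S : Subset r) → MW r S ≡ W r S * pairSum r
MW≡W*pairSum r S = begin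
  MW r S
    ≡⟨ MW≡sum∣S∩T∣C2+sum∣∁S∩T∣C2 r S ⟩
  sumSubsets r (λ T → (∣ S ∩ T ∣ C 2) * w ∣ T ∣) + sumSubsets r (λ T → (∣ ∁ S ∩ T ∣ C 2) * w ∣ T ∣)
    ≡⟨ cong₂ _+_ (sumSubsets-∣∩∣C S 2 w) (sumSubsets-∣∩∣C (∁ S) 2 w) ⟩
  (∣ S ∣ C 2) * pairSum r + (∣ ∁ S ∣ C 2) * pairSum r
    ≡⟨ sym (*-distribʳ-+ (pairSum r) (∣ S ∣ C 2) _) ⟩
  (∣ S ∣ C 2 + ∣ ∁ S ∣ C 2) * pairSum r
    ≡⟨ cong (λ c → (∣ S ∣ C 2 + c C 2) * pairSum r) (∣∁p∣≡n∸∣p∣ S) ⟩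
  W r S * pairSum r ∎
  where
  w : ℕ → ℕ
  w j = j C 2 + (r ∸ j) C 2

pairSum-moments : ∀ n → pairSum (2 + n) ≡ 2 * ((n C 2) * 2 ^ (n ∸ 2)) + 2 * ((n C 1) * 2 ^ (n ∸ 1)) + (n C 0) * 2 ^ n
pairSum-moments n = begin
  sumSubsets n (λ T → (2 + ∣ T ∣) C 2 + (n ∸ ∣ T ∣) C 2)
    ≡⟨ sumSubsets-+ n _ _ ⟩
  sumSubsets n (λ T → (2 + ∣ T ∣) C 2) + sumSubsets n (λ T → (n ∸ ∣ T ∣) C 2)
    ≡⟨ cong₂ _+_ (sumSubsets-cong n (λ T → [2+n]C2 ∣ T ∣)) complement ⟩
  sumSubsets n (λ T → μ 2 T + 2 * μ 1 T + μ 0 T) + Σμ 2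
    ≡⟨ cong (_+ Σμ 2) (trans (sumSubsets-+ n _ _) (cong (_+ Σμ 0) (trans (sumSubsets-+ n _ _) (cong (Σμ 2 +_) (sumSubsets-* n 2 (μ 1)))))) ⟩
  (Σμ 2 + 2 * Σμ 1 + Σμ 0) + Σμ 2
    ≡⟨ regroup (Σμ 0) (Σμ 1) (Σμ 2) ⟩
  2 * Σμ 2 + 2 * Σμ 1 + Σμ 0
    ≡⟨ cong₂ _+_ (cong₂ (λ a b → 2 * a + 2 * b) (sumSubsets-C n 2) (sumSubsets-C n 1)) (sumSubsets-C n 0) ⟩
  2 * ((n C 2) * 2 ^ (n ∸ 2)) + 2 * ((n C 1) * 2 ^ (n ∸ 1)) + (n C 0) * 2 ^ n ∎
  where
  μ : ℕ → Subset n → ℕ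
  μ k T = ∣ T ∣ C k
  Σμ : ℕ → ℕ
  Σμ k = sumSubsets n (μ k)
  complement : sumSubsets n (λ T → (n ∸ ∣ T ∣) C 2) ≡ Σμ 2
  complement = trans (sumSubsets-cong n (λ T → cong (_C 2) (sym (∣∁p∣≡n∸∣p∣ T)))) (sumSubsets-∁ n (μ 2))
  regroup : ∀ s₀ s₁ s₂ → (s₂ + 2 * s₁ + s₀) + s₂ ≡ 2 * s₂ + 2 * s₁ + s₀
  regroup = solve-∀

pairSum≡eigenvalue : ∀ m → pairSum (4 + m) ≡ eigenvalue (4 + m)
pairSum≡eigenvalue m = begin
  pairSum (4 + m)
    ≡⟨ pairSum-moments (2 + m) ⟩
  2 * (c * 2 ^ m) + 2 * (((2 + m) C 1) * 2 ^ (1 + m)) + 1 * 2 ^ (2 + m)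
    ≡⟨ cong (λ a → 2 * (c * 2 ^ m) + 2 * (a * 2 ^ (1 + m)) + 1 * 2 ^ (2 + m)) (nC1≡n (2 + m)) ⟩
  2 * (c * 2 ^ m) + 2 * ((2 + m) * 2 ^ (1 + m)) + 1 * 2 ^ (2 + m)
    ≡⟨ regroup c (2 ^ m) m ⟩
  2 ^ m * (2 * c + (4 * m + 12))
    ≡⟨ cong (λ a → 2 ^ m * (a + (4 * m + 12))) (2*[1+n]C2≡[1+n]*n (suc m)) ⟩
  2 ^ m * ((2 + m) * (1 + m) + (4 * m + 12))
    ≡⟨ cong (2 ^ m *_) (expand m) ⟩
  2 ^ m * ((m * m + 7 * m + 12) + 2)
    ≡⟨ cong (λ a → 2 ^ m * (a + 2)) (sym (r*r∸r (4 + m) (m * m + 7 * m + 12) (square m))) ⟩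
  eigenvalue (4 + m) ∎
  where
  c : ℕ
  c = (2 + m) C 2
  regroup : ∀ c p m → 2 * (c * p) + 2 * ((2 + m) * (2 * p)) + 1 * (2 * (2 * p)) ≡ p * (2 * c + (4 * m + 12))
  regroup = solve-∀
  expand : ∀ m → (2 + m) * (1 + m) + (4 * m + 12) ≡ (m * m + 7 * m + 12) + 2
  expand = solve-∀
  square : ∀ m → (4 + m) * (4 + m) ≡ (m * m + 7 * m + 12) + (4 + m)
  square = solve-∀
  r*r∸r : ∀ r s → r * r ≡ s + r → r * r ∸ r ≡ s
  r*r∸r r s eq = trans (cong (_∸ r) eq) (m+n∸n≡m s r)

W-⊥≢0 : ∀ n → W (2 + n) ⊥ ≢ 0
W-⊥≢0 n W≡0 = 0≢1+n (begin
  0                               ≡⟨ cong (2 *_) (sym W≡0) ⟩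
  2 * W (2 + n) ⊥                 ≡⟨ cong (λ c → 2 * (c C 2 + (2 + n ∸ c) C 2)) (∣⊥∣≡0 (2 + n)) ⟩
  2 * ((2 + n) C 2)               ≡⟨ 2*[1+n]C2≡[1+n]*n (suc n) ⟩
  (2 + n) * (1 + n) ∎)

mainTheorem7 : (r : ℕ) → 4 ≤ r →
    (Σ (Subset r) (λ T → W r T ≢ 0)) ×
    ((S : Subset r) → MW r S ≡ eigenvalue r * W r S)
mainTheorem7 (suc (suc (suc (suc m)))) (s≤s (s≤s (s≤s (s≤s _)))) =
  (⊥ , W-⊥≢0 (2 + m)) , eigenvector
  where
  eigenvector : (S : Subset (4 + m)) → MW (4 + m) S ≡ eigenvalue (4 + m) * W (4 + m) S
  eigenvector S = begin
    MW (4 + m) S                      ≡⟨ MW≡W*pairSum (4 + m) S ⟩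
    W (4 + m) S * pairSum (4 + m)     ≡⟨ cong (W (4 + m) S *_) (pairSum≡eigenvalue m) ⟩
    W (4 + m) S * eigenvalue (4 + m)  ≡⟨ *-comm (W (4 + m) S) _ ⟩
    eigenvalue (4 + m) * W (4 + m) S ∎
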